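{- Every finite simple undirected graph $G$ is the intersection graph of an exactly hittable hypergraph $\mathcal{X}=(\mathcal{U},\mathcal{F})$. Further, if $G$ is a connected chordal graph, then $G$ is the intersection graph of an exactly hittable family of subtrees of a tree.
   Context: Given a set system $\mathcal{X}=(\mathcal{U},\mathcal{F})$, its intersection graph has one vertex $v_F$ for each $F\in\mathcal{F}$, and distinct $v_{F_i},v_{F_j}$ are adjacent iff $F_i\cap F_j\neq\emptyset$; "$G$ is the intersection graph" means isomorphic to it. A family $\mathcal{F}$ of subsets of $\mathcal{U}$ is exactly hittable if there exists $T\subseteq\mathcal{U}$ with $|T\cap F|=1$ for all $F\in\mathcal{F}$. For a family of subtrees of a tree $T$, the universe is the node set of $T$ and each subtree is identified with its node set. A chordal graph is a graph with no induced cycle of length at least 4. -}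

module Defs where

open import Data.Nat using (ℕ; zero; suc; _≤_; _%_)
open import Data.Fin using (Fin; toℕ)
open import Data.Fin.Properties using (_≟_)
open import Data.Fin.Subset using (Subset; _∩_; _∈_; Nonempty; ∣_∣)
open import Data.Fin.Subset.Properties using (nonempty?; ∩-comm)
open import Data.Product using (Σ; _×_; _,_; ∃)
open import Data.Sum using (_⊎_)
open import Function.Bundles using (_↔_; _⇔_; Inverse)
open import Function.Definitions using (Injective)
open import Relation.Binary.PropositionalEquality using (_≡_; _≢_; refl; sym; subst)
open import Relation.Nullary using (¬_; Dec; yes; no)
open import Relation.Nullary.Decidable using (_×-dec_; ¬?)

record Graph (n : ℕ) : Set₁ where
  field
    Adj    : Fin n → Fin n → Set
    adj?   : ∀ u v → Dec (Adj u v)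
    adj-sym    : ∀ {u v} → Adj u v → Adj v u
    adj-irrefl : ∀ {u} → ¬ Adj u u
open Graph public

_≅_ : ∀ {n k} → Graph n → Graph k → Set
_≅_ {n} {k} G H = Σ (Fin n ↔ Fin k) λ σ →
  ∀ u v → (Adj G u v ⇔ Adj H (Inverse.to σ u) (Inverse.to σ v))

-- A set system (U, F) with universe U = Fin m and family F = {F i | i : Fin k};
-- F is a set of subsets, so its members are pairwise distinct (F injective).
record SetSystem (m k : ℕ) : Set where
  field
    sets     : Fin k → Subset m
    distinct : Injective _≡_ _≡_ sets
open SetSystem public

IntersectionGraph : ∀ {m k} → SetSystem m k → Graph k
IntersectionGraph X = record
  { Adj    = λ i j → (i ≢ j) × Nonempty (sets X i ∩ sets X j)
  ; adj?   = λ i j → ¬? (i ≟ j) ×-dec nonempty? (sets X i ∩ sets X j)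
  ; adj-sym    = λ { {i} {j} (i≢j , ne) →
               (λ e → i≢j (sym e)) , subst Nonempty (∩-comm (sets X i) (sets X j)) ne }
  ; adj-irrefl = λ { (i≢i , _) → i≢i refl }
  }

IsIntersectionGraphOf : ∀ {n m k} → Graph n → SetSystem m k → Set
IsIntersectionGraphOf G X = G ≅ IntersectionGraph X

ExactlyHittable : ∀ {m k} → SetSystem m k → Set
ExactlyHittable {m} X = Σ (Subset m) λ T → ∀ i → ∣ T ∩ sets X i ∣ ≡ 1

data Walk {n} (G : Graph n) (P : Fin n → Set) : Fin n → Fin n → Set where
  here : ∀ {u} → P u → Walk G P u u
  step : ∀ {u v w} → P u → Adj G u v → Walk G P v w → Walk G P u w

Connected : ∀ {n} → Graph n → Set
Connected {n} G = ∀ (u v : Fin n) → Walk G (λ _ → Fin n) u v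

CycSucc : ∀ {k} → Fin k → Fin k → Set
CycSucc {k} i j = toℕ j ≡ suc (toℕ i) ⊎ (suc (toℕ i) ≡ k × toℕ j ≡ 0)

record Cycle {n} (G : Graph n) (k : ℕ) : Set where
  field
    len≥3    : 3 ≤ k
    vert     : Fin k → Fin n
    injVert  : Injective _≡_ _≡_ vert
    edges    : ∀ i j → CycSucc i j → Adj G (vert i) (vert j)
open Cycle public

record InducedCycle {n} (G : Graph n) (k : ℕ) : Set where
  field
    cycle   : Cycle G k
    noChord : ∀ i j → Adj G (vert cycle i) (vert cycle j) → CycSucc i j ⊎ CycSucc j i
open InducedCycle public

Chordal : ∀ {n} → Graph n → Set
Chordal G = ∀ k → 4 ≤ k → ¬ InducedCycle G k

IsTree : ∀ {n} → Graph n → Set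
IsTree G = Connected G × (∀ k → ¬ Cycle G k)

-- A subtree of a tree T, identified with its node set: a nonempty set of
-- nodes inducing a connected subgraph of T.
IsSubtree : ∀ {t} → Graph t → Subset t → Set
IsSubtree T S = Nonempty S × (∀ u v → u ∈ S → v ∈ S → Walk T (_∈ S) u v)

module Submission where

-- Both parts are instances of one construction (a "hitting representation"): every
-- vertex u gets a set S u of points containing a private point own u that no other
-- set contains, and distinct S u, S v meet iff u ~ v.  The private points then form
-- an exact hitting set.  For (1) the points are the vertices and the ordered edges.
-- For (2) we follow the classical route: chordal graphs have simplicial vertices
-- (Dirac's lemma), hence a perfect elimination ordering; given one, the tree has a
-- root, a hub node per vertex w hanging below the hub of w's latest earlier neighbour,
-- and a leaf node per vertex below its hub; S u is the leaf and hub of u together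
-- with the hubs of the later neighbours of u.  The tree is a tree because it is given
-- by a parent map that strictly decreases a height, and S u is connected because the
-- perfect elimination property makes the parent chain from a later neighbour's hub
-- stay inside S u.

open import Defs
open import Data.Nat using (ℕ; zero; suc; _+_; _*_; _≤_; _<_; z≤n; s≤s)
open import Data.Nat.Properties
  using ( _<?_; <-cmp; suc-injective; ≤-refl; ≤-reflexive; ≤-trans; ≤-antisym; ≤-pred; <-trans; <-≤-trans
        ; <-asym; <-irrefl; ≤∧≢⇒<; ≮⇒≥; ≤⇒≯; n≤1+n; m≤n+m; +-identityʳ; +-suc; +-monoˡ-≤; +-mono-< )
open import Data.Fin using (Fin; toℕ; fromℕ; fromℕ<; inject₁) renaming (zero to fzero; suc to fsuc)
open import Data.Fin.Properties
  using (_≟_; any?; toℕ-injective; toℕ-fromℕ; toℕ-fromℕ<; toℕ-inject₁; toℕ<n; +↔⊎; *↔×; 1↔⊤)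
open import Data.Fin.Subset using (Subset; ∣_∣; _∩_; Nonempty; ⁅_⁆; _∈_)
open import Data.Fin.Subset.Properties
  using (⊆-antisym; x∈⁅x⁆; x∈⁅y⁆⇒x≡y; ∣⁅x⁆∣≡1; p⊂q⇒∣p∣<∣q∣; ∣p∣≤n; x∈p∩q⁺; x∈p∩q⁻)
open import Data.Vec using (tabulate)
open import Data.Vec.Properties using (lookup∘tabulate; []=⇒lookup; lookup⇒[]=)
open import Data.Bool.Properties using (T-≡)
open import Data.List using (List; []; _∷_; filter; allFin; length; lookup)
open import Data.List.Membership.Propositional using () renaming (_∈_ to _∈ₗ_)
open import Data.List.Membership.Propositional.Properties using (∈-filter⁺; ∈-allFin; ∈-lookup)
open import Data.List.Relation.Unary.All using (All; []; _∷_) renaming (lookup to All-lookup)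
open import Data.List.Relation.Unary.Any using (Any; here; there) renaming (any? to anyₗ?)
import Data.List.Relation.Unary.Any as Any
open import Data.List.Relation.Unary.All.Properties using (all-filter)
open import Data.List.Extrema.Nat using (argmax; argmax-all; f[xs]≤f[argmax])
open import Data.Product using (Σ; ∃; _×_; _,_; proj₁; proj₂)
open import Data.Sum using (_⊎_; inj₁; inj₂)
import Data.Sum as Sum
open import Data.Sum.Function.Propositional using (_⊎-↔_)
open import Data.Unit using (⊤; tt)
open import Data.Unit.Properties using () renaming (_≟_ to _≟⊤_)
open import Data.Sum.Properties using () renaming (≡-dec to ≡-dec⊎)
open import Data.Empty using (⊥; ⊥-elim)
open import Function.Bundles using (_↔_; _⇔_; mk⇔; Inverse; Equivalence)
open import Function.Properties.Inverse using (↔-refl; ↔-sym; ↔-trans)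
open import Relation.Binary.PropositionalEquality using (_≡_; _≢_; ≢-sym; refl; sym; trans; cong; subst; subst₂)
open import Relation.Nullary using (¬_; Dec; yes; no)
open import Relation.Binary using (DecidableEquality; tri<; tri≈; tri>)
open import Relation.Nullary.Decidable using (⌊_⌋; toWitness; fromWitness; _×-dec_; _⊎-dec_; ¬?)
open import Relation.Unary using (Decidable)

module _ {n} {G : Graph n} {P : Fin n → Set} where

  walk-++ : ∀ {u v w} → Walk G P u v → Walk G P v w → Walk G P u w
  walk-++ (here _)     q = q
  walk-++ (step p a w) q = step p a (walk-++ w q)

  walk-snoc : ∀ {u v w} → Walk G P u v → Adj G v w → P w → Walk G P u w
  walk-snoc (here p)     b q = step p b (here q)
  walk-snoc (step p a w) b q = step p a (walk-snoc w b q)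

  walk-reverse : ∀ {u v} → Walk G P u v → Walk G P v u
  walk-reverse (here p)     = here p
  walk-reverse (step p a w) = walk-snoc (walk-reverse w) (adj-sym G a) p

adjacent⇒distinct : ∀ {n} (G : Graph n) {u v} → Adj G u v → u ≢ v
adjacent⇒distinct G u~v refl = adj-irrefl G u~v

walk-map : ∀ {n} {G : Graph n} {P Q : Fin n → Set} →
           (∀ {x} → P x → Q x) → ∀ {u v} → Walk G P u v → Walk G Q u v
walk-map f (here p)     = here (f p)
walk-map f (step p a w) = step (f p) a (walk-map f w)

toSubset : ∀ {m} {P : Fin m → Set} → Decidable P → Subset m
toSubset P? = tabulate (λ x → ⌊ P? x ⌋)

size : ∀ {m} {P : Fin m → Set} → Decidable P → ℕ
size P? = ∣ toSubset P? ∣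

module _ {m} {P : Fin m → Set} (P? : Decidable P) where

  ∈-toSubset⁺ : ∀ {x} → P x → x ∈ toSubset P?
  ∈-toSubset⁺ {x} p =
    lookup⇒[]= x _ (trans (lookup∘tabulate _ x) (Equivalence.to T-≡ (fromWitness {a? = P? x} p)))

  ∈-toSubset⁻ : ∀ {x} → x ∈ toSubset P? → P x
  ∈-toSubset⁻ {x} x∈ =
    toWitness {a? = P? x} (Equivalence.from T-≡ (trans (sym (lookup∘tabulate _ x)) ([]=⇒lookup x∈)))

  size-≤ : size P? ≤ m
  size-≤ = ∣p∣≤n (toSubset P?)

size-< : ∀ {m} {P Q : Fin m → Set} (P? : Decidable P) (Q? : Decidable Q) →
         (∀ {x} → P x → Q x) → ∀ {a} → Q a → ¬ P a → size P? < size Q?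
size-< P? Q? P⊆Q {a} qa ¬pa = p⊂q⇒∣p∣<∣q∣
  ( (λ x∈P → ∈-toSubset⁺ Q? (P⊆Q (∈-toSubset⁻ P? x∈P)))
  , a , ∈-toSubset⁺ Q? qa , (λ a∈P → ¬pa (∈-toSubset⁻ P? a∈P)) )

∣p∣≡1 : ∀ {m} (p : Subset m) {x : Fin m} → x ∈ p → (∀ {y} → y ∈ p → y ≡ x) → ∣ p ∣ ≡ 1
∣p∣≡1 p {x} x∈p only = trans (cong ∣_∣ p≡⁅x⁆) (∣⁅x⁆∣≡1 x)
  where
  p≡⁅x⁆ : p ≡ ⁅ x ⁆
  p≡⁅x⁆ = ⊆-antisym (λ y∈p → subst (_∈ ⁅ x ⁆) (sym (only y∈p)) (x∈⁅x⁆ x))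
                    (λ y∈⁅x⁆ → subst (_∈ p) (sym (x∈⁅y⁆⇒x≡y x y∈⁅x⁆)) x∈p)

maximise : ∀ {m} {P : Fin m → Set} (P? : Decidable P) (f : Fin m → ℕ) → ∀ {x} → P x →
           Σ (Fin m) λ z → P z × (∀ {y} → P y → f y ≤ f z)
maximise {m} P? f {x} px =
  z , argmax-all f px (all-filter P? (allFin m)) ,
  λ py → All-lookup (f[xs]≤f[argmax] x candidates) (∈-filter⁺ P? (∈-allFin _) py)
  where
  candidates : List (Fin m)
  candidates = filter P? (allFin m)
  z : Fin m
  z = argmax f x candidates

module Enumerated {A : Set} {m : ℕ} (enum : A ↔ Fin m) where

  code : A → Fin m
  code = Inverse.to enum

  decode : Fin m → A
  decode = Inverse.from enum

  decode-code : ∀ a → decode (code a) ≡ a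
  decode-code = Inverse.strictlyInverseʳ enum

  code-decode : ∀ i → code (decode i) ≡ i
  code-decode = Inverse.strictlyInverseˡ enum

  subsetOf : {P : A → Set} → Decidable P → Subset m
  subsetOf P? = toSubset (λ i → P? (decode i))

  ∈-subsetOf⁺ : ∀ {P : A → Set} (P? : Decidable P) {a} → P a → code a ∈ subsetOf P?
  ∈-subsetOf⁺ {P} P? {a} pa = ∈-toSubset⁺ (λ i → P? (decode i)) (subst P (sym (decode-code a)) pa)

  ∈-subsetOf⁻ : ∀ {P : A → Set} (P? : Decidable P) {i} → i ∈ subsetOf P? → P (decode i)
  ∈-subsetOf⁻ P? = ∈-toSubset⁻ (λ i → P? (decode i))

  decode-injective : ∀ {i j} → decode i ≡ decode j → i ≡ j
  decode-injective {i} {j} e = trans (sym (code-decode i)) (trans (cong code e) (code-decode j))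

  ∈-subsetOf⁻′ : ∀ {P : A → Set} (P? : Decidable P) {a} → code a ∈ subsetOf P? → P a
  ∈-subsetOf⁻′ {P} P? {a} a∈ = subst P (decode-code a) (∈-subsetOf⁻ P? a∈)

record HittingRepresentation {n} (G : Graph n) (A : Set) : Set₁ where
  field
    Mem           : Fin n → A → Set
    mem?          : ∀ u → Decidable (Mem u)
    Private       : A → Set
    private?      : Decidable Private
    own           : Fin n → A
    own-mem       : ∀ u → Mem u (own u)
    own-private   : ∀ u → Private (own u)
    own-unique    : ∀ {u a} → Private a → Mem u a → a ≡ own u
    own-exclusive : ∀ {u v} → Mem v (own u) → u ≡ v
    adjacent⇔     : ∀ {u v} → u ≢ v → Adj G u v ⇔ (∃ λ a → Mem u a × Mem v a)

module RepresentedSystem {n m} {G : Graph n} {A : Set}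
                         (enum : A ↔ Fin m) (R : HittingRepresentation G A) where
  open HittingRepresentation R
  open Enumerated enum

  system : SetSystem m n
  system = record
    { sets     = λ u → subsetOf (mem? u)
    ; distinct = λ {u} {v} Su≡Sv → own-exclusive
        (∈-subsetOf⁻′ (mem? v) (subst (code (own u) ∈_) Su≡Sv (∈-subsetOf⁺ (mem? u) (own-mem u))))
    }

  hittable : ExactlyHittable system
  hittable = subsetOf private? , λ u →
    ∣p∣≡1 _ (x∈p∩q⁺ (∈-subsetOf⁺ private? (own-private u) , ∈-subsetOf⁺ (mem? u) (own-mem u)))
      λ {i} i∈ → let (i∈T , i∈Su) = x∈p∩q⁻ (subsetOf private?) (subsetOf (mem? u)) i∈ in
        trans (sym (code-decode i))
              (cong code (own-unique (∈-subsetOf⁻ private? i∈T) (∈-subsetOf⁻ (mem? u) i∈Su)))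

  represents : IsIntersectionGraphOf G system
  represents = ↔-refl , λ u v → mk⇔ (to u v) (from u v)
    where
    to : ∀ u v → Adj G u v → u ≢ v × Nonempty (sets system u ∩ sets system v)
    to u v u~v with Equivalence.to (adjacent⇔ (adjacent⇒distinct G u~v)) u~v
    ... | a , a∈u , a∈v =
      adjacent⇒distinct G u~v , code a , x∈p∩q⁺ (∈-subsetOf⁺ (mem? u) a∈u , ∈-subsetOf⁺ (mem? v) a∈v)
    from : ∀ u v → u ≢ v × Nonempty (sets system u ∩ sets system v) → Adj G u v
    from u v (u≢v , i , i∈) with x∈p∩q⁻ (sets system u) (sets system v) i∈
    ... | i∈u , i∈v =
      Equivalence.from (adjacent⇔ u≢v) (decode i , ∈-subsetOf⁻ (mem? u) i∈u , ∈-subsetOf⁻ (mem? v) i∈v)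

module AnyGraph {n} (G : Graph n) where

  Point : Set
  Point = Fin n ⊎ (Fin n × Fin n)

  pattern vertexPt u = inj₁ u
  pattern pairPt x y = inj₂ (x , y)

  enum : Point ↔ Fin (n + n * n)
  enum = ↔-sym (↔-trans +↔⊎ (↔-refl ⊎-↔ *↔×))

  Mem : Fin n → Point → Set
  Mem u (vertexPt w) = w ≡ u
  Mem u (pairPt x y) = Adj G x y × (x ≡ u ⊎ y ≡ u)

  IsVertex : Point → Set
  IsVertex (vertexPt _) = ⊤
  IsVertex (pairPt _ _) = ⊥

  shared⇒adjacent : ∀ {u v} a → u ≢ v → Mem u a → Mem v a → Adj G u v
  shared⇒adjacent (vertexPt w) u≢v refl refl = ⊥-elim (u≢v refl)
  shared⇒adjacent (pairPt x y) u≢v (xy , inj₁ refl) (_ , inj₁ refl) = ⊥-elim (u≢v refl)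
  shared⇒adjacent (pairPt x y) u≢v (xy , inj₁ refl) (_ , inj₂ refl) = xy
  shared⇒adjacent (pairPt x y) u≢v (xy , inj₂ refl) (_ , inj₁ refl) = adj-sym G xy
  shared⇒adjacent (pairPt x y) u≢v (xy , inj₂ refl) (_ , inj₂ refl) = ⊥-elim (u≢v refl)

  representation : HittingRepresentation G Point
  representation = record
    { Mem           = Mem
    ; mem?          = λ { u (vertexPt w) → w ≟ u
                        ; u (pairPt x y) → adj? G x y ×-dec ((x ≟ u) ⊎-dec (y ≟ u)) }
    ; Private       = IsVertex
    ; private?      = λ { (vertexPt _) → yes tt ; (pairPt _ _) → no λ () }
    ; own           = vertexPt
    ; own-mem       = λ _ → refl
    ; own-private   = λ _ → tt
    ; own-unique    = λ { {a = vertexPt w} _ refl → refl }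
    ; own-exclusive = λ { refl → refl }
    ; adjacent⇔     = λ {u} {v} u≢v → mk⇔ (λ uv → pairPt u v , (uv , inj₁ refl) , (uv , inj₂ refl))
                                          (λ (a , a∈u , a∈v) → shared⇒adjacent a u≢v a∈u a∈v)
    }

  open RepresentedSystem enum representation public using (system; hittable; represents)

module InducedPaths {n} (G : Graph n) where

  _~_ : Fin n → Fin n → Set
  _~_ = Adj G

  data InducedPath : List (Fin n) → Set where
    single : ∀ {x} → InducedPath (x ∷ [])
    cons   : ∀ {x y l} → x ~ y → (∀ {z} → z ∈ₗ l → x ≢ z × ¬ x ~ z) →
             InducedPath (y ∷ l) → InducedPath (x ∷ y ∷ l)

  data EndsAt (e : Fin n) : List (Fin n) → Set where
    last : EndsAt e (e ∷ [])
    _∷_  : ∀ x {l} → EndsAt e l → EndsAt e (x ∷ l)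

  lastIndex : ∀ {e l} → EndsAt e l → Σ (Fin (length l)) λ i → lookup l i ≡ e × suc (toℕ i) ≡ length l
  lastIndex last = fzero , refl , refl
  lastIndex (_ ∷ p) with lastIndex p
  ... | i , li≡e , i-last = fsuc i , li≡e , cong suc i-last

  consecutive-adjacent : ∀ {l} → InducedPath l → ∀ i j → toℕ j ≡ suc (toℕ i) → lookup l i ~ lookup l j
  consecutive-adjacent (cons xy _ _) fzero    (fsuc fzero)    _ = xy
  consecutive-adjacent (cons _ _ p)  (fsuc i) (fsuc j)        e = consecutive-adjacent p i j (suc-injective e)
  consecutive-adjacent single        fzero    fzero           ()
  consecutive-adjacent (cons _ _ _)  fzero    fzero           ()
  consecutive-adjacent (cons _ _ _)  fzero    (fsuc (fsuc _)) ()
  consecutive-adjacent (cons _ _ _)  (fsuc _) fzero           ()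

  only-consecutive-adjacent : ∀ {l} → InducedPath l → ∀ i j → lookup l i ~ lookup l j →
                              toℕ j ≡ suc (toℕ i) ⊎ toℕ i ≡ suc (toℕ j)
  only-consecutive-adjacent single        fzero           fzero           a = ⊥-elim (adj-irrefl G a)
  only-consecutive-adjacent (cons _ _ _)  fzero           fzero           a = ⊥-elim (adj-irrefl G a)
  only-consecutive-adjacent (cons _ _ _)  fzero           (fsuc fzero)    _ = inj₁ refl
  only-consecutive-adjacent (cons _ _ _)  (fsuc fzero)    fzero           _ = inj₂ refl
  only-consecutive-adjacent (cons _ far _) fzero          (fsuc (fsuc j)) a = ⊥-elim (proj₂ (far (∈-lookup j)) a)
  only-consecutive-adjacent (cons _ far _) (fsuc (fsuc i)) fzero          a =
    ⊥-elim (proj₂ (far (∈-lookup i)) (adj-sym G a))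
  only-consecutive-adjacent (cons _ _ p)  (fsuc i)        (fsuc j)        a =
    Sum.map (cong suc) (cong suc) (only-consecutive-adjacent p i j a)

  lookup-injective : ∀ {l} → InducedPath l → ∀ i j → lookup l i ≡ lookup l j → i ≡ j
  lookup-injective single        fzero           fzero           _ = refl
  lookup-injective (cons _ _ _)  fzero           fzero           _ = refl
  lookup-injective (cons xy _ _) fzero           (fsuc fzero)    e = ⊥-elim (adj-irrefl G (subst (_~ _) e xy))
  lookup-injective (cons xy _ _) (fsuc fzero)    fzero           e = ⊥-elim (adj-irrefl G (subst (_~ _) (sym e) xy))
  lookup-injective (cons _ far _) fzero          (fsuc (fsuc j)) e = ⊥-elim (proj₁ (far (∈-lookup j)) e)
  lookup-injective (cons _ far _) (fsuc (fsuc i)) fzero          e = ⊥-elim (proj₁ (far (∈-lookup i)) (sym e))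
  lookup-injective (cons _ _ p)  (fsuc i)        (fsuc j)        e = cong fsuc (lookup-injective p i j e)

  long-path : ∀ {s₁ s₂ q} → InducedPath (s₁ ∷ q) → EndsAt s₂ (s₁ ∷ q) →
              s₁ ≢ s₂ → ¬ s₁ ~ s₂ → 2 ≤ length q
  long-path {q = []}          _               last             s₁≢s₂ _     = ⊥-elim (s₁≢s₂ refl)
  long-path {q = _ ∷ []}      (cons s₁~w _ _) (_ ∷ last)       _     s₁≁s₂ = ⊥-elim (s₁≁s₂ s₁~w)
  long-path {q = _ ∷ _ ∷ _}   _               _                _     _     = s≤s (s≤s z≤n)

  module ApexCycle {a s₁ s₂ q}
      (path : InducedPath (s₁ ∷ q)) (ends : EndsAt s₂ (s₁ ∷ q))
      (s₁≢s₂ : s₁ ≢ s₂) (s₁≁s₂ : ¬ s₁ ~ s₂) (a~s₁ : a ~ s₁) (a~s₂ : a ~ s₂)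
      (apex-only : ∀ {z} → z ∈ₗ s₁ ∷ q → z ≡ s₁ ⊎ z ≡ s₂ ⊎ (a ≢ z × ¬ a ~ z)) where

    k : ℕ
    k = suc (length (s₁ ∷ q))

    vertex : Fin k → Fin n
    vertex = lookup (a ∷ s₁ ∷ q)

    last-vertex : ∀ i → suc (toℕ i) ≡ length (s₁ ∷ q) → lookup (s₁ ∷ q) i ≡ s₂
    last-vertex i i-last with lastIndex ends
    ... | j , lj≡s₂ , j-last =
      trans (cong (lookup (s₁ ∷ q)) (toℕ-injective (suc-injective (trans i-last (sym j-last))))) lj≡s₂

    apex-off-path : ∀ {z} → z ∈ₗ s₁ ∷ q → a ≢ z
    apex-off-path z∈ with apex-only z∈
    ... | inj₁ refl             = λ { refl → adj-irrefl G a~s₁ }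
    ... | inj₂ (inj₁ refl)      = λ { refl → adj-irrefl G a~s₂ }
    ... | inj₂ (inj₂ (a≢z , _)) = a≢z

    vertex-injective : ∀ i j → vertex i ≡ vertex j → i ≡ j
    vertex-injective fzero    fzero    _ = refl
    vertex-injective fzero    (fsuc j) e = ⊥-elim (apex-off-path (∈-lookup j) e)
    vertex-injective (fsuc i) fzero    e = ⊥-elim (apex-off-path (∈-lookup i) (sym e))
    vertex-injective (fsuc i) (fsuc j) e = cong fsuc (lookup-injective path i j e)

    cycle-edges : ∀ i j → CycSucc i j → vertex i ~ vertex j
    cycle-edges fzero    (fsuc fzero)    (inj₁ _)       = a~s₁
    cycle-edges (fsuc i) (fsuc j)        (inj₁ e)       = consecutive-adjacent path i j (suc-injective e)
    cycle-edges (fsuc i) fzero           (inj₂ (e , _)) =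
      subst (_~ a) (sym (last-vertex i (suc-injective e))) (adj-sym G a~s₂)
    cycle-edges fzero    fzero           (inj₁ ())
    cycle-edges fzero    (fsuc (fsuc _)) (inj₁ ())
    cycle-edges fzero    _               (inj₂ (() , _))
    cycle-edges (fsuc _) fzero           (inj₁ ())
    cycle-edges (fsuc _) (fsuc _)        (inj₂ (_ , ()))

    apex-chords : ∀ j → a ~ lookup (s₁ ∷ q) j → CycSucc {k} fzero (fsuc j) ⊎ CycSucc {k} (fsuc j) fzero
    apex-chords j a~z with apex-only (∈-lookup j)
    ... | inj₁ z≡s₁ with lookup-injective path j fzero z≡s₁
    ...   | refl = inj₁ (inj₁ refl)
    apex-chords j a~z | inj₂ (inj₁ z≡s₂) with lastIndex ends
    ...   | l , ll≡s₂ , l-last with lookup-injective path j l (trans z≡s₂ (sym ll≡s₂))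
    ...     | refl = inj₂ (inj₂ (cong suc l-last , refl))
    apex-chords j a~z | inj₂ (inj₂ (_ , a≁z)) = ⊥-elim (a≁z a~z)

    no-chord : ∀ i j → vertex i ~ vertex j → CycSucc i j ⊎ CycSucc j i
    no-chord fzero    fzero    x = ⊥-elim (adj-irrefl G x)
    no-chord fzero    (fsuc j) x = apex-chords j x
    no-chord (fsuc i) fzero    x = Sum.swap (apex-chords i (adj-sym G x))
    no-chord (fsuc i) (fsuc j) x =
      Sum.map (λ e → inj₁ (cong suc e)) (λ e → inj₁ (cong suc e)) (only-consecutive-adjacent path i j x)

    length≥4 : 4 ≤ k
    length≥4 = s≤s (s≤s (long-path path ends s₁≢s₂ s₁≁s₂))

    induced-cycle : InducedCycle G k
    induced-cycle = record
      { cycle   = record { len≥3 = ≤-trans (n≤1+n 3) length≥4 ; vert = vertex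
                         ; injVert = λ {i} {j} → vertex-injective i j ; edges = cycle-edges }
      ; noChord = no-chord }

    impossible : Chordal G → ⊥
    impossible chordal = chordal k length≥4 induced-cycle

  record InducedPathIn (Q : Fin n → Set) (x e : Fin n) : Set where
    constructor inducedPath
    field
      rest    : List (Fin n)
      induced : InducedPath (x ∷ rest)
      ends    : EndsAt e (x ∷ rest)
      inside  : All Q (x ∷ rest)

  private
    Hits : Fin n → Fin n → Set
    Hits x y = x ≡ y ⊎ x ~ y

    hits? : ∀ x → Decidable (Hits x)
    hits? x y = (x ≟ y) ⊎-dec adj? G x y

    induced-tail : ∀ {y ys} {R : Fin n → Set} → InducedPath (y ∷ ys) → Any R ys → InducedPath ys
    induced-tail (cons _ _ p) _ = p

    ends-tail : ∀ {e y ys} {R : Fin n → Set} → EndsAt e (y ∷ ys) → Any R ys → EndsAt e ys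
    ends-tail (_ ∷ p) _ = p

  -- Prepend x to an induced path that x hits, by cutting the path at the last vertex x hits.
  prepend : ∀ {Q e x} ys → InducedPath ys → EndsAt e ys → All Q ys → Q x → Any (Hits x) ys →
            InducedPathIn Q x e
  prepend {x = x} (y ∷ ys) path ends (qy ∷ qys) qx hit with anyₗ? (hits? x) ys
  ... | yes later = prepend ys (induced-tail path later) (ends-tail ends later) qys qx later
  ... | no none with hit
  ...   | there later     = ⊥-elim (none later)
  ...   | here (inj₁ refl) = inducedPath ys path ends (qy ∷ qys)
  ...   | here (inj₂ x~y) = inducedPath (y ∷ ys) (cons x~y far path) (x ∷ ends) (qx ∷ qy ∷ qys)
    where
    far : ∀ {z} → z ∈ₗ ys → x ≢ z × ¬ x ~ z
    far z∈ = (λ x≡z → none (Any.map (λ z≡w → subst (Hits x) z≡w (inj₁ x≡z)) z∈))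
           , (λ x~z → none (Any.map (λ z≡w → subst (Hits x) z≡w (inj₂ x~z)) z∈))

  shortcut : ∀ {Q x e} → Walk G Q x e → InducedPathIn Q x e
  shortcut (here qx) = inducedPath [] single last (qx ∷ [])
  shortcut (step qx x~y w) with shortcut w
  ... | inducedPath q path ends inside = prepend (_ ∷ q) path ends inside qx (here (inj₂ x~y))

record ComponentIn {n} (G : Graph n) (A : Fin n → Set) (b : Fin n) : Set₁ where
  field
    Member  : Fin n → Set
    member? : Decidable Member
    root    : Member b
    inside  : ∀ {x} → Member x → A x
    closed  : ∀ {x y} → Member x → Adj G x y → A y → Member y
    walk    : ∀ {x} → Member x → Walk G Member x b

-- Components exist: grow the breadth-first layers around b until they stabilise, which
-- happens after at most n steps since each non-final step adds a vertex.
module _ {n} (G : Graph n) {A : Fin n → Set} (A? : Decidable A) {b} (Ab : A b) where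

  private
    Layer : ℕ → Fin n → Set
    Layer zero    x = x ≡ b
    Layer (suc j) x = Layer j x ⊎ (A x × ∃ λ y → Layer j y × Adj G y x)

    layer? : ∀ j → Decidable (Layer j)
    layer? zero    x = x ≟ b
    layer? (suc j) x = layer? j x ⊎-dec (A? x ×-dec any? (λ y → layer? j y ×-dec adj? G y x))

    layer-root : ∀ j → Layer j b
    layer-root zero    = refl
    layer-root (suc j) = inj₁ (layer-root j)

    layer-inside : ∀ j {x} → Layer j x → A x
    layer-inside zero    refl             = Ab
    layer-inside (suc j) (inj₁ x∈)        = layer-inside j x∈
    layer-inside (suc j) (inj₂ (Ax , _))  = Ax

    layer-walk : ∀ j {x} → Layer j x → Walk G (Layer j) x b
    layer-walk zero    refl      = here refl
    layer-walk (suc j) (inj₁ x∈) = walk-map inj₁ (layer-walk j x∈)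
    layer-walk (suc j) (inj₂ x∈@(_ , y , y∈ , y~x)) =
      step (inj₂ x∈) (adj-sym G y~x) (walk-map inj₁ (layer-walk j y∈))

    stabilise : ∀ fuel j → n < size (layer? j) + fuel → Σ ℕ λ J → ∀ {x} → Layer (suc J) x → Layer J x
    stabilise fuel j bound with any? (λ x → layer? (suc j) x ×-dec ¬? (layer? j x))
    ... | no nothing-new = j , λ {x} x∈ → stay x x∈ (layer? j x)
      where
      stay : ∀ x → Layer (suc j) x → Dec (Layer j x) → Layer j x
      stay x _  (yes x∈) = x∈
      stay x x∈ (no x∉) = ⊥-elim (nothing-new (x , x∈ , x∉))
    stabilise zero j bound | yes _ =
      ⊥-elim (≤⇒≯ (≤-trans (≤-reflexive (+-identityʳ _)) (size-≤ (layer? j))) bound)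
    stabilise (suc fuel) j bound | yes (x , x∈ , x∉) = stabilise fuel (suc j)
      (<-≤-trans bound (≤-trans (≤-reflexive (+-suc _ fuel))
                               (+-monoˡ-≤ fuel (size-< (layer? j) (layer? (suc j)) inj₁ x∈ x∉))))

    stable : Σ ℕ λ J → ∀ {x} → Layer (suc J) x → Layer J x
    stable = stabilise (suc n) 0 (m≤n+m (suc n) _)

    J : ℕ
    J = proj₁ stable

  component : ComponentIn G A b
  component = record
    { Member  = Layer J
    ; member? = layer? J
    ; root    = layer-root J
    ; inside  = layer-inside J
    ; closed  = λ x∈ x~y Ay → proj₂ stable (inj₂ (Ay , _ , x∈ , x~y))
    ; walk    = layer-walk J
    }

module SimplicialVertices {n} (G : Graph n) where

  open InducedPaths G using (_~_; InducedPathIn; inducedPath; shortcut; module ApexCycle)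

  Simplicial : (Fin n → Set) → Fin n → Set
  Simplicial P v = ∀ {x y} → P x → P y → x ~ v → y ~ v → x ≢ y → x ~ y

  gap-or-clique : ∀ {P : Fin n → Set} → Decidable P →
                  (Σ (Fin n) λ x → Σ (Fin n) λ y → P x × P y × y ≢ x × ¬ x ~ y)
                  ⊎ (∀ {x y} → P x → P y → x ≢ y → x ~ y)
  gap-or-clique {P} P?
    with any? (λ x → P? x ×-dec any? (λ y → P? y ×-dec (¬? (y ≟ x) ×-dec ¬? (adj? G x y))))
  ... | yes (x , px , y , py , y≢x , x≁y) = inj₁ (x , y , px , py , y≢x , x≁y)
  ... | no no-gap = inj₂ λ {x} {y} px py x≢y → adjacent px py x≢y (adj? G x y)
    where
    adjacent : ∀ {x y} → P x → P y → x ≢ y → Dec (x ~ y) → x ~ y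
    adjacent _  _  _   (yes x~y) = x~y
    adjacent px py x≢y (no x≁y)  = ⊥-elim (no-gap (_ , px , _ , py , ≢-sym x≢y , x≁y))

  FarSimplicial : (Fin n → Set) → Fin n → Set
  FarSimplicial P a = Σ (Fin n) λ v → P v × v ≢ a × ¬ a ~ v × Simplicial P v

  Dirac : (Fin n → Set) → Set
  Dirac P = ∀ {a b} → P a → P b → b ≢ a → ¬ a ~ b → FarSimplicial P a

  -- Let C be the component of b among the vertices of P far from a, and B the vertices
  -- of P outside C with a neighbour in C.  Every vertex of B is adjacent to a, and by
  -- chordality B is a clique.  W = C ∪ B is smaller than P (it misses a), so it has a
  -- simplicial vertex in C, which is simplicial in P since its P-neighbours lie in W.
  module DiracStep (chordal : Chordal G) {P : Fin n → Set} (P? : Decidable P)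
                   (smaller : ∀ {Q : Fin n → Set} (Q? : Decidable Q) → size Q? < size P? → Dirac Q)
                   {a b} (pa : P a) (pb : P b) (b≢a : b ≢ a) (a≁b : ¬ a ~ b) where

    Far : Fin n → Set
    Far x = P x × x ≢ a × ¬ a ~ x

    far? : Decidable Far
    far? x = P? x ×-dec (¬? (x ≟ a) ×-dec ¬? (adj? G a x))

    open ComponentIn (component G far? (pb , b≢a , a≁b))
      renaming (Member to C; member? to C?; inside to C-far; closed to C-closed; walk to C-walk)

    Boundary : Fin n → Set
    Boundary s = P s × ¬ C s × ∃ λ c → C c × s ~ c

    boundary? : Decidable Boundary
    boundary? s = P? s ×-dec (¬? (C? s) ×-dec any? (λ c → C? c ×-dec adj? G s c))

    boundary-near : ∀ {s} → Boundary s → a ~ s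
    boundary-near {s} (ps , s∉C , c , c∈C , s~c) with adj? G a s | s ≟ a
    ... | yes a~s | _      = a~s
    ... | no  _   | yes refl = ⊥-elim (proj₂ (proj₂ (C-far c∈C)) s~c)
    ... | no  a≁s | no s≢a = ⊥-elim (s∉C (C-closed c∈C (adj-sym G s~c) (ps , s≢a , a≁s)))

    CWith : Fin n → Fin n → Fin n → Set
    CWith s₁ s₂ z = z ≡ s₁ ⊎ z ≡ s₂ ⊎ C z

    walk-through-C : ∀ {s₁ s₂} → Boundary s₁ → Boundary s₂ → Walk G (CWith s₁ s₂) s₁ s₂
    walk-through-C (_ , _ , c₁ , c₁∈C , s₁~c₁) (_ , _ , c₂ , c₂∈C , s₂~c₂) =
      step (inj₁ refl) s₁~c₁
      (walk-snoc (walk-++ (walk-map via-C (C-walk c₁∈C)) (walk-reverse (walk-map via-C (C-walk c₂∈C))))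
                 (adj-sym G s₂~c₂) (inj₂ (inj₁ refl)))
      where
      via-C : ∀ {z} → C z → CWith _ _ z
      via-C z∈C = inj₂ (inj₂ z∈C)

    -- Two nonadjacent boundary vertices are the ends of an induced path through C; with
    -- the apex a, which is far from C, it would form a long induced cycle.
    boundary-clique : ∀ {s₁ s₂} → Boundary s₁ → Boundary s₂ → s₁ ≢ s₂ → s₁ ~ s₂
    boundary-clique {s₁} {s₂} B₁ B₂ s₁≢s₂ with adj? G s₁ s₂ | shortcut (walk-through-C B₁ B₂)
    ... | yes s₁~s₂ | _ = s₁~s₂
    ... | no s₁≁s₂ | inducedPath _ path ends inside =
      ⊥-elim (ApexCycle.impossible path ends s₁≢s₂ s₁≁s₂ (boundary-near B₁) (boundary-near B₂) apex-only chordal)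
      where
      apex-only : ∀ {z} → z ∈ₗ _ → z ≡ s₁ ⊎ z ≡ s₂ ⊎ (a ≢ z × ¬ a ~ z)
      apex-only z∈ = Sum.map₂ (Sum.map₂ (λ z∈C → let (_ , z≢a , a≁z) = C-far z∈C in ≢-sym z≢a , a≁z))
                              (All-lookup inside z∈)

    W : Fin n → Set
    W x = C x ⊎ Boundary x

    W? : Decidable W
    W? x = C? x ⊎-dec boundary? x

    W-smaller : size W? < size P?
    W-smaller = size-< W? P? W⊆P pa a∉W
      where
      W⊆P : ∀ {x} → W x → P x
      W⊆P (inj₁ x∈C) = proj₁ (C-far x∈C)
      W⊆P (inj₂ x∈B) = proj₁ x∈B
      a∉W : ¬ W a
      a∉W (inj₁ a∈C) = proj₁ (proj₂ (C-far a∈C)) refl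
      a∉W (inj₂ a∈B) = adj-irrefl G (boundary-near a∈B)

    -- The P-neighbours of a vertex of C lie in W, so simplicial in W means simplicial in P.
    simplicial-in-P : ∀ {v} → C v → Simplicial W v → Simplicial P v
    simplicial-in-P {v} v∈C simplicial px py x~v y~v = simplicial (into-W px x~v) (into-W py y~v) x~v y~v
      where
      into-W : ∀ {x} → P x → x ~ v → W x
      into-W {x} px x~v with C? x
      ... | yes x∈C = inj₁ x∈C
      ... | no  x∉C = inj₂ (px , x∉C , v , v∈C , x~v)

    -- W has a simplicial vertex in C: apply Dirac's lemma to W at a vertex with a
    -- non-neighbour in W; a vertex far from a boundary vertex is not in the clique B.
    from-boundary : ∀ {s y} → Boundary s → W y → y ≢ s → ¬ s ~ y → Σ (Fin n) λ v → C v × Simplicial W v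
    from-boundary s∈B y∈W y≢s s≁y with smaller W? W-smaller (inj₂ s∈B) y∈W y≢s s≁y
    ... | v , inj₁ v∈C , _ , _ , simplicial = v , v∈C , simplicial
    ... | v , inj₂ v∈B , v≢s , s≁v , _      = ⊥-elim (s≁v (boundary-clique s∈B v∈B (≢-sym v≢s)))

    from-gap : ∀ {x y} → W x → W y → y ≢ x → ¬ x ~ y → Σ (Fin n) λ v → C v × Simplicial W v
    from-gap (inj₂ x∈B) y∈W y≢x x≁y = from-boundary x∈B y∈W y≢x x≁y
    from-gap (inj₁ x∈C) y∈W y≢x x≁y with smaller W? W-smaller (inj₁ x∈C) y∈W y≢x x≁y
    ... | v , inj₁ v∈C , _ , _ , simplicial = v , v∈C , simplicial
    ... | v , inj₂ v∈B , v≢x , x≁v , _      = from-boundary v∈B (inj₁ x∈C) (≢-sym v≢x) (λ v~x → x≁v (adj-sym G v~x))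

    simplicial-in-W : Σ (Fin n) λ v → C v × Simplicial W v
    simplicial-in-W with gap-or-clique W?
    ... | inj₁ (x , y , x∈W , y∈W , y≢x , x≁y) = from-gap x∈W y∈W y≢x x≁y
    ... | inj₂ clique = b , root , λ x∈W y∈W _ _ x≢y → clique x∈W y∈W x≢y

    far-simplicial : FarSimplicial P a
    far-simplicial with simplicial-in-W
    ... | v , v∈C , simplicial = let (pv , v≢a , a≁v) = C-far v∈C in
      v , pv , v≢a , a≁v , simplicial-in-P v∈C simplicial

  dirac : Chordal G → ∀ fuel {P : Fin n → Set} (P? : Decidable P) → size P? < fuel → Dirac P
  dirac chordal (suc fuel) P? bound =
    DiracStep.far-simplicial chordal P? (λ Q? smaller → dirac chordal fuel Q? (<-≤-trans smaller (≤-pred bound)))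

  simplicial-exists : Chordal G → ∀ {P : Fin n → Set} (P? : Decidable P) → ∀ {x} → P x →
                      Σ (Fin n) λ v → P v × Simplicial P v
  simplicial-exists chordal P? {x} px with gap-or-clique P?
  ... | inj₁ (a , b , pa , pb , b≢a , a≁b) =
    let (v , pv , _ , _ , simplicial) = dirac chordal (suc (size P?)) P? ≤-refl pa pb b≢a a≁b in v , pv , simplicial
  ... | inj₂ clique = x , px , λ py pz _ _ y≢z → clique py pz y≢z

-- Perfect elimination orderings, presented by ranks.
module PerfectElimination {n} (G : Graph n) where

  open InducedPaths G using (_~_)
  open SimplicialVertices G using (Simplicial; simplicial-exists)

  record PerfectRanking (P : Fin n → Set) (bound : ℕ) : Set where
    field
      rank           : Fin n → ℕ
      rank-injective : ∀ {u w} → P u → P w → rank u ≡ rank w → u ≡ w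
      rank-bounded   : ∀ {u} → P u → rank u < bound
      perfect        : ∀ {u x y} → P u → P x → P y → x ~ u → y ~ u →
                       rank x < rank u → rank y < rank u → x ≢ y → x ~ y

  empty-ranking : ∀ {P bound} → (∀ u → ¬ P u) → PerfectRanking P bound
  empty-ranking empty = record
    { rank = λ _ → 0
    ; rank-injective = λ pu _ _ → ⊥-elim (empty _ pu)
    ; rank-bounded   = λ pu → ⊥-elim (empty _ pu)
    ; perfect        = λ pu _ _ _ _ _ _ _ → ⊥-elim (empty _ pu) }

  _－_ : (Fin n → Set) → Fin n → Fin n → Set
  (P － v) u = P u × u ≢ v

  module Extend {P : Fin n → Set} {v b b′} (pv : P v) (simplicial : Simplicial P v)
                (old : PerfectRanking (P － v) b) (b<b′ : b < b′) where

    open PerfectRanking old renaming (rank to old-rank)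

    rank : Fin n → ℕ
    rank u with u ≟ v
    ... | yes _ = b
    ... | no  _ = old-rank u

    rank-v : rank v ≡ b
    rank-v with v ≟ v
    ... | yes _   = refl
    ... | no  v≢v = ⊥-elim (v≢v refl)

    rank-other : ∀ {u} → u ≢ v → rank u ≡ old-rank u
    rank-other {u} u≢v with u ≟ v
    ... | yes u≡v = ⊥-elim (u≢v u≡v)
    ... | no  _   = refl

    below-v : ∀ {u} → P u → u ≢ v → rank u < rank v
    below-v pu u≢v = subst₂ _<_ (sym (rank-other u≢v)) (sym rank-v) (rank-bounded (pu , u≢v))

    not-v-if-below : ∀ {u x} → P u → u ≢ v → rank x < rank u → x ≢ v
    not-v-if-below pu u≢v x<u refl = <-asym x<u (below-v pu u≢v)

    -- (The case splits below receive `u ≟ v` as a value, so that `rank u` stays intact.)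
    injective : ∀ {u w} → P u → P w → rank u ≡ rank w → u ≡ w
    injective {u} {w} pu pw ru≡rw = by-cases (u ≟ v) (w ≟ v)
      where
      by-cases : Dec (u ≡ v) → Dec (w ≡ v) → u ≡ w
      by-cases (yes u≡v) (yes w≡v) = trans u≡v (sym w≡v)
      by-cases (yes u≡v) (no w≢v)  =
        ⊥-elim (<-irrefl (trans (sym ru≡rw) (cong rank u≡v)) (below-v pw w≢v))
      by-cases (no u≢v)  (yes w≡v) =
        ⊥-elim (<-irrefl (trans ru≡rw (cong rank w≡v)) (below-v pu u≢v))
      by-cases (no u≢v)  (no w≢v)  =
        rank-injective (pu , u≢v) (pw , w≢v) (trans (sym (rank-other u≢v)) (trans ru≡rw (rank-other w≢v)))

    bounded : ∀ {u} → P u → rank u < b′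
    bounded {u} pu = by-cases (u ≟ v)
      where
      v<b′ : rank v < b′
      v<b′ = subst (_< b′) (sym rank-v) b<b′
      by-cases : Dec (u ≡ v) → rank u < b′
      by-cases (yes u≡v) = subst (λ z → rank z < b′) (sym u≡v) v<b′
      by-cases (no u≢v)  = <-trans (below-v pu u≢v) v<b′

    perfect′ : ∀ {u x y} → P u → P x → P y → x ~ u → y ~ u → rank x < rank u → rank y < rank u → x ≢ y → x ~ y
    perfect′ {u} {x} {y} pu px py x~u y~u x<u y<u x≢y = by-cases (u ≟ v)
      where
      by-cases : Dec (u ≡ v) → x ~ y
      by-cases (yes refl) = simplicial px py x~u y~u x≢y
      by-cases (no u≢v)   = perfect (pu , u≢v) (px , x≢v) (py , y≢v) x~u y~u (lower x≢v x<u) (lower y≢v y<u) x≢y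
        where
        x≢v : x ≢ v
        x≢v = not-v-if-below pu u≢v x<u
        y≢v : y ≢ v
        y≢v = not-v-if-below pu u≢v y<u
        lower : ∀ {z} → z ≢ v → rank z < rank u → old-rank z < old-rank u
        lower z≢v = subst₂ _<_ (rank-other z≢v) (rank-other u≢v)

    ranking : PerfectRanking P b′
    ranking = record { rank = rank ; rank-injective = injective ; rank-bounded = bounded ; perfect = perfect′ }

  -- Chordal graphs have perfect rankings of every vertex set: rank a simplicial vertex
  -- on top of a perfect ranking of the rest.
  perfect-ranking : Chordal G → ∀ fuel {P : Fin n → Set} (P? : Decidable P) → size P? < fuel →
                    PerfectRanking P (size P?)
  perfect-ranking chordal (suc fuel) P? bound with any? P?
  ... | no empty = empty-ranking λ u pu → empty (u , pu)
  ... | yes (_ , px) with simplicial-exists chordal P? px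
  ...   | v , pv , simplicial =
    Extend.ranking pv simplicial (perfect-ranking chordal fuel without-v? (<-≤-trans smaller (≤-pred bound))) smaller
    where
    without-v? : Decidable (_ － v)
    without-v? u = P? u ×-dec ¬? (u ≟ v)
    smaller : size without-v? < size P?
    smaller = size-< without-v? P? proj₁ pv (λ pv′ → proj₂ pv′ refl)

  Everything : Fin n → Set
  Everything _ = ⊤

  everything? : Decidable Everything
  everything? _ = yes tt

  full-ranking : Chordal G → PerfectRanking Everything (size everything?)
  full-ranking chordal = perfect-ranking chordal (suc n) everything? (s≤s (size-≤ everything?))

cyclic-successor : ∀ {k} (i : Fin k) → Σ (Fin k) (CycSucc i)
cyclic-successor {suc k} i with suc (toℕ i) <? suc k
... | yes i+1<k = fromℕ< i+1<k , inj₁ (toℕ-fromℕ< i+1<k)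
... | no  i+1≮k = fzero , inj₂ (≤-antisym (toℕ<n i) (≮⇒≥ i+1≮k) , refl)

cyclic-predecessor : ∀ {k} (i : Fin k) → Σ (Fin k) λ j → CycSucc j i
cyclic-predecessor {suc k} fzero    = fromℕ k , inj₂ (cong suc (toℕ-fromℕ k) , refl)
cyclic-predecessor {suc k} (fsuc i) = inject₁ i , inj₁ (cong suc (sym (toℕ-inject₁ i)))

cyclic-asymmetric : ∀ {k} → 3 ≤ k → (i j : Fin k) → CycSucc i j → CycSucc j i → ⊥
cyclic-asymmetric _ i j (inj₁ j≡1+i) (inj₁ i≡1+j) =
  <-asym (≤-reflexive (sym j≡1+i)) (≤-reflexive (sym i≡1+j))
cyclic-asymmetric 3≤k i j (inj₁ j≡1+i) (inj₂ (1+j≡k , i≡0)) =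
  ≤⇒≯ (≤-reflexive (trans (sym 1+j≡k) (cong suc (trans j≡1+i (cong suc i≡0))))) 3≤k
cyclic-asymmetric 3≤k i j (inj₂ (1+i≡k , j≡0)) (inj₁ i≡1+j) =
  ≤⇒≯ (≤-reflexive (trans (sym 1+i≡k) (cong suc (trans i≡1+j (cong suc j≡0))))) 3≤k
cyclic-asymmetric 3≤k i j (inj₂ (_ , j≡0)) (inj₂ (1+j≡k , _)) =
  ≤⇒≯ (≤-trans (≤-reflexive (trans (sym 1+j≡k) (cong suc j≡0))) (n≤1+n 1)) 3≤k

-- A parent map on an enumerated node type A that strictly lowers a height away from the
-- root defines a tree: every node walks up to the root, and on a cycle the highest node
-- would have both cycle-neighbours as its parent.
module ParentTree {A : Set} {t} (enum : A ↔ Fin t) (_≟ᴬ_ : DecidableEquality A)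
                  (root : A) (parent : A → A) (height : A → ℕ)
                  (descends : ∀ {a} → a ≢ root → height (parent a) < height a) where

  open Enumerated enum

  ChildOf : A → A → Set
  ChildOf a b = a ≢ root × parent a ≡ b

  child? : ∀ a b → Dec (ChildOf a b)
  child? a b = ¬? (a ≟ᴬ root) ×-dec (parent a ≟ᴬ b)

  child-irreflexive : ∀ {a} → ¬ ChildOf a a
  child-irreflexive {a} (a≢root , pa≡a) = <-irrefl (cong height pa≡a) (descends a≢root)

  tree : Graph t
  tree = record
    { Adj        = λ i j → ChildOf (decode i) (decode j) ⊎ ChildOf (decode j) (decode i)
    ; adj?       = λ i j → child? (decode i) (decode j) ⊎-dec child? (decode j) (decode i)
    ; adj-sym    = Sum.swap
    ; adj-irrefl = Sum.[ child-irreflexive , child-irreflexive ]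
    }

  child-adjacent : ∀ {a b} → ChildOf a b → Adj tree (code a) (code b)
  child-adjacent {a} {b} a→b = inj₁ (subst₂ ChildOf (sym (decode-code a)) (sym (decode-code b)) a→b)

  Anywhere : Fin t → Set
  Anywhere _ = Fin t

  walk-to-root : ∀ fuel i → height (decode i) < fuel → Walk tree Anywhere i (code root)
  walk-to-root (suc fuel) i bound with decode i ≟ᴬ root
  ... | yes i-root = subst (Walk tree Anywhere i) (trans (sym (code-decode i)) (cong code i-root)) (here i)
  ... | no  i≢root = step i (inj₁ (i≢root , sym (decode-code _)))
      (walk-to-root fuel (code (parent (decode i)))
        (subst (λ a → height a < fuel) (sym (decode-code _)) (<-≤-trans (descends i≢root) (≤-pred bound))))

  connected : Connected tree
  connected i j = walk-++ (walk-to-root _ i ≤-refl) (walk-reverse (walk-to-root _ j ≤-refl))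

  module _ {k} (c : Cycle tree k) where

    private
      node : Fin k → A
      node i = decode (vert c i)

    neighbour-of-highest : ∀ {m} → (∀ i → height (node i) ≤ height (node m)) →
                           ∀ i → Adj tree (vert c m) (vert c i) → parent (node m) ≡ node i
    neighbour-of-highest highest i (inj₁ (_ , e))         = e
    neighbour-of-highest highest i (inj₂ (i≢root , e)) =
      ⊥-elim (<-irrefl refl (<-≤-trans (subst (λ a → height a < height (node i)) e (descends i≢root)) (highest i)))

    no-cycle : ⊥
    no-cycle with maximise (λ (_ : Fin k) → yes tt) (λ i → height (node i)) {fromℕ< (≤-trans (s≤s z≤n) (len≥3 c))} tt
    ... | m , _ , highest′ with cyclic-predecessor m | cyclic-successor m
    ...   | j , j→m | l , m→l = cyclic-asymmetric (len≥3 c) j m j→m (subst (CycSucc m) (sym j≡l) m→l)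
      where
      highest : ∀ i → height (node i) ≤ height (node m)
      highest i = highest′ {i} tt
      j≡l : j ≡ l
      j≡l = injVert c (decode-injective
              (trans (sym (neighbour-of-highest highest j (adj-sym tree (edges c j m j→m))))
                     (neighbour-of-highest highest l (edges c m l m→l))))

  acyclic : ∀ k → ¬ Cycle tree k
  acyclic _ c = no-cycle c

  is-tree : IsTree tree
  is-tree = connected , acyclic

module CliqueTree {n} (G : Graph n) {b}
                  (ranking : PerfectElimination.PerfectRanking G (PerfectElimination.Everything G) b) where

  open InducedPaths G using (_~_)
  open PerfectElimination.PerfectRanking ranking

  Earlier : Fin n → Fin n → Set
  Earlier u w = u ~ w × rank u < rank w

  earlier? : ∀ u w → Dec (Earlier u w)
  earlier? u w = adj? G u w ×-dec (rank u <? rank w)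

  Node : Set
  Node = ⊤ ⊎ (Fin n ⊎ Fin n)

  pattern root   = inj₁ tt
  pattern hub w  = inj₂ (inj₁ w)
  pattern leaf w = inj₂ (inj₂ w)

  enum : Node ↔ Fin (suc (n + n))
  enum = ↔-sym (↔-trans +↔⊎ (1↔⊤ ⊎-↔ +↔⊎))

  _≟ᴺ_ : DecidableEquality Node
  _≟ᴺ_ = ≡-dec⊎ _≟⊤_ (≡-dec⊎ _≟_ _≟_)

  data ParentView (w : Fin n) : Set where
    latest : ∀ p → Earlier p w → (∀ {y} → Earlier y w → rank y ≤ rank p) → ParentView w
    first  : (∀ {u} → ¬ Earlier u w) → ParentView w

  parentView : ∀ w → ParentView w
  parentView w with any? (λ u → earlier? u w)
  ... | yes (_ , e) = let (p , earlier , latest-one) = maximise (λ u → earlier? u w) rank e in latest p earlier latest-one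
  ... | no  none    = first λ e → none (_ , e)

  hubParent : ∀ {w} → ParentView w → Node
  hubParent (latest p _ _) = hub p
  hubParent (first _)      = root

  parent : Node → Node
  parent root     = root
  parent (hub w)  = hubParent (parentView w)
  parent (leaf w) = hub w

  height : Node → ℕ
  height root     = 0
  height (hub w)  = suc (rank w + rank w)
  height (leaf w) = suc (suc (rank w + rank w))

  descends : ∀ {a} → a ≢ root → height (parent a) < height a
  descends {root}   root≢root = ⊥-elim (root≢root refl)
  descends {hub w}  _         = hub-descends (parentView w)
    where
    hub-descends : (view : ParentView w) → height (hubParent view) < height (hub w)
    hub-descends (latest p (_ , p<w) _) = s≤s (+-mono-< p<w p<w)
    hub-descends (first _)              = s≤s z≤n
  descends {leaf w} _         = ≤-refl

  open ParentTree enum _≟ᴺ_ root parent height descends public using (tree; is-tree; child-adjacent)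

  Mem : Fin n → Node → Set
  Mem u root     = ⊥
  Mem u (hub w)  = w ≡ u ⊎ Earlier u w
  Mem u (leaf w) = w ≡ u

  mem? : ∀ u → Decidable (Mem u)
  mem? u root     = no λ ()
  mem? u (hub w)  = (w ≟ u) ⊎-dec earlier? u w
  mem? u (leaf w) = w ≟ u

  IsLeaf : Node → Set
  IsLeaf (leaf _) = ⊤
  IsLeaf _        = ⊥

  isLeaf? : Decidable IsLeaf
  isLeaf? root     = no λ ()
  isLeaf? (hub _)  = no λ ()
  isLeaf? (leaf _) = yes tt

  shared⇒adjacent : ∀ {u v} a → u ≢ v → Mem u a → Mem v a → u ~ v
  shared⇒adjacent (leaf w) u≢v refl refl = ⊥-elim (u≢v refl)
  shared⇒adjacent (hub w) u≢v (inj₁ refl)        (inj₁ refl)        = ⊥-elim (u≢v refl)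
  shared⇒adjacent (hub w) u≢v (inj₁ refl)        (inj₂ (v~u , _))   = adj-sym G v~u
  shared⇒adjacent (hub w) u≢v (inj₂ (u~v , _))   (inj₁ refl)        = u~v
  shared⇒adjacent (hub w) u≢v (inj₂ (u~w , u<w)) (inj₂ (v~w , v<w)) = perfect tt tt tt u~w v~w u<w v<w u≢v

  adjacent⇒shared : ∀ {u v} → u ~ v → ∃ λ a → Mem u a × Mem v a
  adjacent⇒shared {u} {v} u~v with <-cmp (rank u) (rank v)
  ... | tri< u<v _ _ = hub v , inj₂ (u~v , u<v) , inj₁ refl
  ... | tri≈ _ u≡v _ = ⊥-elim (adjacent⇒distinct G u~v (rank-injective tt tt u≡v))
  ... | tri> _ _ v<u = hub u , inj₁ refl , inj₂ (adj-sym G u~v , v<u)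

  representation : HittingRepresentation G Node
  representation = record
    { Mem           = Mem
    ; mem?          = mem?
    ; Private       = IsLeaf
    ; private?      = isLeaf?
    ; own           = leaf
    ; own-mem       = λ _ → refl
    ; own-private   = λ _ → tt
    ; own-unique    = λ { {a = leaf w} _ refl → refl }
    ; own-exclusive = λ { refl → refl }
    ; adjacent⇔     = λ u≢v → mk⇔ adjacent⇒shared (λ (a , a∈u , a∈v) → shared⇒adjacent a u≢v a∈u a∈v)
    }

  open RepresentedSystem enum representation public using (system; hittable; represents)
  open Enumerated enum

  InSet : Fin n → Fin (suc (n + n)) → Set
  InSet u = _∈ sets system u

  ∈-set : ∀ {u a} → Mem u a → InSet u (code a)
  ∈-set = ∈-subsetOf⁺ (mem? _)

  -- From the hub of a later neighbour w of u, the parent chain reaches the hub of u inside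
  -- the set of u: the next hub up is the latest earlier neighbour p of w, and if p ≠ u
  -- then u, p are earlier neighbours of w, hence adjacent, and u is earlier than p.
  climb : ∀ {u} fuel w → rank w < fuel → Earlier u w → Walk tree (InSet u) (code (hub w)) (code (hub u))
  climb {u} (suc fuel) w bound u→w with parentView w in view
  ... | first none = ⊥-elim (none u→w)
  ... | latest p p→w p-latest =
    step (∈-set (inj₂ u→w)) (child-adjacent ((λ ()) , cong hubParent view)) (continue (p ≟ u))
    where
    continue : Dec (p ≡ u) → Walk tree (InSet u) (code (hub p)) (code (hub u))
    continue (yes refl) = here (∈-set (inj₁ refl))
    continue (no p≢u)   = climb fuel p (<-≤-trans (proj₂ p→w) (≤-pred bound)) u→p
      where
      u→p : Earlier u p
      u→p = perfect tt tt tt (proj₁ u→w) (proj₁ p→w) (proj₂ u→w) (proj₂ p→w) (≢-sym p≢u)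
          , ≤∧≢⇒< (p-latest u→w) (λ r≡ → p≢u (sym (rank-injective tt tt r≡)))

  walk-to-hub : ∀ u a → Mem u a → Walk tree (InSet u) (code a) (code (hub u))
  walk-to-hub u (hub w)  (inj₁ refl) = here (∈-set (inj₁ refl))
  walk-to-hub u (hub w)  (inj₂ u→w)  = climb (suc (rank w)) w ≤-refl u→w
  walk-to-hub u (leaf w) refl        = step (∈-set refl) (child-adjacent {leaf u} ((λ ()) , refl)) (here (∈-set (inj₁ refl)))

  subtree : ∀ u → IsSubtree tree (sets system u)
  subtree u = (code (leaf u) , ∈-set refl) , λ i j i∈ j∈ → walk-++ (to-hub i i∈) (walk-reverse (to-hub j j∈))
    where
    to-hub : ∀ i → InSet u i → Walk tree (InSet u) i (code (hub u))
    to-hub i i∈ = subst (λ k → Walk tree (InSet u) k (code (hub u))) (code-decode i)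
                        (walk-to-hub u (decode i) (∈-subsetOf⁻ (mem? u) i∈))

theorem10 : ∀ {n} (G : Graph n) →
      (Σ ℕ λ m → Σ ℕ λ k → Σ (SetSystem m k) λ X →
         ExactlyHittable X × IsIntersectionGraphOf G X)
    × (Connected G → Chordal G →
         Σ ℕ λ t → Σ (Graph t) λ T → IsTree T × (Σ ℕ λ k → Σ (SetSystem t k) λ X →
           (∀ i → IsSubtree T (sets X i)) × ExactlyHittable X × IsIntersectionGraphOf G X))
theorem10 G =
    (_ , _ , AnyGraph.system G , AnyGraph.hittable G , AnyGraph.represents G)
  , λ _ chordal → let open CliqueTree G (PerfectElimination.full-ranking G chordal) in
      _ , tree , is-tree , _ , system , subtree , hittable , represents
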